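{- Let $n=6$ and let $\mathtt{A}=[a_{ij}]$ be the $6\times 6$ matrix with $a_{ij}=1$ if $j=i+1$ or $i+j=7$, and $a_{ij}=0$ otherwise. For $k\ge 1$ let $f(k)=v_6\mathtt{A}^{k-1}v_6^T$, where $v_6=[1\ 1\ 1\ 1\ 1\ 1]$, i.e. $f(k)$ is the number of sequences $(i_1,\dots,i_k)\in\{1,\dots,6\}^k$ with $a_{i_ti_{t+1}}=1$ for all $t$. Then $f(k)=2F_{k+3}$ for all $k\ge 1$, where $F_j$ are the Fibonacci numbers ($F_0=0$, $F_1=1$, $F_{j+1}=F_j+F_{j-1}$).
   Context: In the paper's interpretation, $f(k)$ is the number of meaningful differential operations of order $k$ in $\mathbb{R}^6$ built from the operators $\nabla_r=\varphi_r\circ d\circ\varphi_{r-1}^{ -1}$ ($d$ the exterior derivative, $\varphi_r$ identifying $r$-forms with vector functions), where $\nabla_1:A_0\to A_1,\nabla_2:A_1\to A_2,\nabla_3:A_2\to A_3,\nabla_4:A_3\to A_2,\nabla_5:A_2\to A_1,\nabla_6:A_1\to A_0$ and $a_{ij}=1$ exactly when $\nabla_j\circ\nabla_i$ is meaningful. -}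

module Defs where

open import Data.Nat using (ℕ; zero; suc; _+_; _*_; _∸_; _≟_)
open import Data.Fin using (Fin; toℕ)
open import Data.Vec.Functional using (Vector; foldr)
open import Relation.Nullary.Decidable using (does)
open import Data.Bool using (_∨_; if_then_else_)

Σ : ∀ {n} → (Fin n → ℕ) → ℕ
Σ v = foldr _+_ 0 v

-- square matrices over ℕ, indexed by Fin n (index i : Fin 6 stands for i+1)
Matrix : ℕ → Set
Matrix n = Fin n → Fin n → ℕ

_⊗_ : ∀ {n} → Matrix n → Matrix n → Matrix n
(A ⊗ B) i j = Σ (λ l → A i l * B l j)

I : ∀ {n} → Matrix n
I i j = if does (toℕ i ≟ toℕ j) then 1 else 0

_^ᴹ_ : ∀ {n} → Matrix n → ℕ → Matrix n
A ^ᴹ zero = I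
A ^ᴹ suc m = A ⊗ (A ^ᴹ m)

ones : ∀ {n} → Fin n → ℕ
ones _ = 1

quad : ∀ {n} → Matrix n → ℕ
quad M = Σ (λ i → Σ (λ j → ones i * M i j * ones j))

-- a_{ij} = 1 iff j = i+1 or i+j = 7 (1-based indices); with 0-based
-- toℕ i = i-1: j = i+1 ⇔ toℕ j = suc (toℕ i); i+j = 7 written literally with suc (toℕ ·)
A6 : Matrix 6
A6 i j = if does (toℕ j ≟ suc (toℕ i)) ∨ does (suc (toℕ i) + suc (toℕ j) ≟ 7) then 1 else 0

f : ℕ → ℕ
f k = quad (A6 ^ᴹ (k ∸ 1))

F : ℕ → ℕ
F zero = 0
F (suc zero) = 1
F (suc (suc j)) = F (suc j) + F j

-- The row sums of A^m take only two values: F (m + 2) on the indices 1, 2, 4, 5 and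
-- F (m + 1) on 3, 6.  Indeed the row-sum vector of A^(m+1) is A applied to that of A^m,
-- and A sends a vector with values (a, b) in this pattern to the one with values
-- (a + b, a), which is the Fibonacci step.  Hence f (m + 1) = 4 F (m + 2) + 2 F (m + 1)
-- = 2 F (m + 4).
module Submission where

open import Defs
open import Data.Nat using (ℕ; _≥_; _*_; _+_; zero; suc; s≤s)
open import Data.Nat.Properties using (+-*-semiring; *-identityˡ; *-identityʳ; +-comm)
open import Data.Fin using (Fin; zero; suc)
open import Data.Nat.Tactic.RingSolver using (solve-∀)
open import Relation.Binary.PropositionalEquality
open import Algebra.Properties.Semiring.Sum +-*-semiring
  using (sum-cong-≗; ∑-comm; *-distribˡ-sum)
open ≡-Reasoning

Σ-rows-⊗ : ∀ {n} (A B : Matrix n) i → Σ ((A ⊗ B) i) ≡ Σ (λ l → A i l * Σ (B l))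
Σ-rows-⊗ A B i = begin
  Σ (λ j → Σ (λ l → A i l * B l j))  ≡⟨ ∑-comm (λ j l → A i l * B l j) ⟩
  Σ (λ l → Σ (λ j → A i l * B l j))  ≡⟨ sum-cong-≗ (λ l → sym (*-distribˡ-sum (A i l) (B l))) ⟩
  Σ (λ l → A i l * Σ (B l))          ∎

quad≡Σ-rows : ∀ {n} (M : Matrix n) → quad M ≡ Σ (λ i → Σ (M i))
quad≡Σ-rows M =
  sum-cong-≗ (λ i → sum-cong-≗ (λ j → trans (*-identityʳ (1 * M i j)) (*-identityˡ (M i j))))

-- Normal forms of Σ (λ l → A6 i l * x l) for a row of A6 with two, resp. one, nonzero entries.
two-neighbours : ∀ x y → 1 * x + (1 * y + 0) ≡ x + y
two-neighbours = solve-∀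

one-neighbour : ∀ x → 1 * x + 0 ≡ x
one-neighbour = solve-∀

rowPattern : ℕ → ℕ → Fin 6 → ℕ
rowPattern a b zero = a
rowPattern a b (suc zero) = a
rowPattern a b (suc (suc zero)) = b
rowPattern a b (suc (suc (suc zero))) = a
rowPattern a b (suc (suc (suc (suc zero)))) = a
rowPattern a b (suc (suc (suc (suc (suc zero))))) = b

A6-rowPattern : ∀ a b i → Σ (λ l → A6 i l * rowPattern a b l) ≡ rowPattern (a + b) a i
A6-rowPattern a b zero = two-neighbours a b
A6-rowPattern a b (suc zero) = trans (two-neighbours b a) (+-comm b a)
A6-rowPattern a b (suc (suc zero)) = one-neighbour a
A6-rowPattern a b (suc (suc (suc zero))) = trans (two-neighbours b a) (+-comm b a)
A6-rowPattern a b (suc (suc (suc (suc zero)))) = two-neighbours a b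
A6-rowPattern a b (suc (suc (suc (suc (suc zero))))) = one-neighbour a

Σ-rows-A6^ : ∀ m i → Σ ((A6 ^ᴹ m) i) ≡ rowPattern (F (2 + m)) (F (1 + m)) i
Σ-rows-A6^ zero zero = refl
Σ-rows-A6^ zero (suc zero) = refl
Σ-rows-A6^ zero (suc (suc zero)) = refl
Σ-rows-A6^ zero (suc (suc (suc zero))) = refl
Σ-rows-A6^ zero (suc (suc (suc (suc zero)))) = refl
Σ-rows-A6^ zero (suc (suc (suc (suc (suc zero))))) = refl
Σ-rows-A6^ (suc m) i = begin
  Σ ((A6 ⊗ (A6 ^ᴹ m)) i)
    ≡⟨ Σ-rows-⊗ A6 (A6 ^ᴹ m) i ⟩
  Σ (λ l → A6 i l * Σ ((A6 ^ᴹ m) l))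
    ≡⟨ sum-cong-≗ (λ l → cong (A6 i l *_) (Σ-rows-A6^ m l)) ⟩
  Σ (λ l → A6 i l * rowPattern (F (2 + m)) (F (1 + m)) l)
    ≡⟨ A6-rowPattern (F (2 + m)) (F (1 + m)) i ⟩
  rowPattern (F (3 + m)) (F (2 + m)) i
    ∎

Σ-rowPattern : ∀ a b → Σ (rowPattern a b) ≡ 2 * (a + b + a)
Σ-rowPattern = unfolded
  where
  unfolded : ∀ a b → a + (a + (b + (a + (a + (b + 0))))) ≡ 2 * (a + b + a)
  unfolded = solve-∀

mainTheorem6 : ∀ (k : ℕ) → k ≥ 1 → f k ≡ 2 * F (k + 3)
mainTheorem6 (suc m) (s≤s _) = begin
  quad (A6 ^ᴹ m)                          ≡⟨ quad≡Σ-rows (A6 ^ᴹ m) ⟩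
  Σ (λ i → Σ ((A6 ^ᴹ m) i))               ≡⟨ sum-cong-≗ (Σ-rows-A6^ m) ⟩
  Σ (rowPattern (F (2 + m)) (F (1 + m)))  ≡⟨ Σ-rowPattern (F (2 + m)) (F (1 + m)) ⟩
  2 * F (3 + suc m)                       ≡⟨ cong (λ j → 2 * F j) (+-comm 3 (suc m)) ⟩
  2 * F (suc m + 3)                       ∎
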